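{- Let $w\ge1$ and let $x$ be a $w$-bit word whose bits $x_0$ (least significant), $x_1,\dots,x_{w-1}$ are regarded as Boolean variables. For $0\le b<w$, let $z_b$ be bit $b$ of $3x \bmod 2^w$, viewed as a Boolean function of $x_0,\dots,x_{w-1}$. Then the number of monomials in the algebraic normal form of $z_b$ is \[ (2+[\,b\text{ odd}\,])\cdot 2^{\lfloor b/2\rfloor}-1 . \]
   Context: $[P]$ is $1$ if the condition $P$ holds and $0$ otherwise. The algebraic normal form of a Boolean function is its unique representation as a sum over $\mathbf Z/2\mathbf Z$ of distinct squarefree monomials in the variables. -}

module Defs where

open import Data.Bool using (Bool; true; false; _∧_; _∨_; _xor_; not)
open import Data.Nat using (ℕ; zero; suc; _+_; _*_; _^_; _%_; _/_; _≡ᵇ_)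
open import Data.Nat.Properties using (m^n≢0)
open import Data.Fin using (Fin; toℕ)
open import Data.Vec using (Vec; []; _∷_; zipWith; foldr)
open import Data.List using (List; []; _∷_; map; _++_; filter; length)
open import Data.Bool using (T)
open import Relation.Binary.PropositionalEquality using (_≡_)

-- A w-bit word / assignment of the Boolean variables x_0 … x_{w-1};
-- entry i of the vector is bit x_i (x_0 least significant).
Word : ℕ → Set
Word w = Vec Bool w

bitVal : Bool → ℕ
bitVal true  = 1
bitVal false = 0

value : ∀ {w} → Word w → ℕ
value []       = 0
value (x ∷ xs) = bitVal x + 2 * value xs

bit : ℕ → ℕ → Bool
bit n b = ((_/_ n (2 ^ b) {{m^n≢0 2 b}}) % 2) ≡ᵇ 1

z : (w : ℕ) → Fin w → Word w → Bool
z w b x = bit (_%_ (3 * value x) (2 ^ w) {{m^n≢0 2 w}}) (toℕ b)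

-- Monomials: squarefree monomials are subsets S of the variables,
-- encoded as a characteristic vector; m_S(x) = ∏_{i ∈ S} x_i.
Monomial : ℕ → Set
Monomial w = Vec Bool w

evalMonomial : ∀ {w} → Monomial w → Word w → Bool
evalMonomial S x = foldr _ _∧_ true (zipWith (λ s xi → not s ∨ xi) S x)

allVecs : (w : ℕ) → List (Vec Bool w)
allVecs zero    = [] ∷ []
allVecs (suc w) = map (false ∷_) (allVecs w) ++ map (true ∷_) (allVecs w)

xorList : List Bool → Bool
xorList []       = false
xorList (b ∷ bs) = b xor xorList bs

evalPoly : ∀ {w} → (Monomial w → Bool) → Word w → Bool
evalPoly {w} c x = xorList (map (λ S → c S ∧ evalMonomial S x) (allVecs w))

IsANF : ∀ {w} → (Word w → Bool) → (Monomial w → Bool) → Set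
IsANF f c = ∀ x → evalPoly c x ≡ f x

numMonomials : ∀ {w} → (Monomial w → Bool) → ℕ
numMonomials {w} c = length (filter (λ S → T? (c S)) (allVecs w))
  where
  open import Relation.Nullary.Decidable using (Dec)
  open import Data.Bool.Properties using (T?)

oddInd : ℕ → ℕ
oddInd n = n % 2

-- Splitting on x₀, the algebraic normal form of f is anf f₀ + x₀ · anf (f₀ ⊕ f₁),
-- where fᵢ is f with x₀ := i, so it has |anf f₀| + |anf (f₀ ⊕ f₁)| monomials.
-- Let f⁽ᶜ⁾_b be bit b of 3x + c.  Setting x₀ := i turns f⁽ᶜ⁾_{b+1} into
-- f⁽ᶜ′⁾_b of the remaining bits, with carry c′ = ⌊(3i + c)/2⌋ ∈ {0, 1, 2}; hence
--   |anf f⁽⁰⁾_{b+1}|          = |anf f⁽⁰⁾_b| + |anf (f⁽⁰⁾_b ⊕ f⁽¹⁾_b)|,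
--   |anf (f⁽⁰⁾ ⊕ f⁽¹⁾)_{b+1}| = |anf (f⁽¹⁾_b ⊕ f⁽²⁾_b)|,
--   |anf (f⁽¹⁾ ⊕ f⁽²⁾)_{b+1}| = 2 |anf (f⁽⁰⁾_b ⊕ f⁽¹⁾_b)|.
-- So |anf f⁽⁰⁾_b| + 1 = |anf (f⁽⁰⁾ ⊕ f⁽¹⁾)_b| + |anf (f⁽¹⁾ ⊕ f⁽²⁾)_b|, and
-- this quantity doubles every two steps, starting from 2 and 3.
module Submission where

open import Defs
open import Data.Nat using (ℕ; _+_; _*_; _^_; _∸_; _/_; _≤_)
open import Data.Fin using (Fin; toℕ)
open import Data.Bool using (Bool)
open import Data.Product using (_×_; ∃-syntax)
open import Relation.Binary.PropositionalEquality using (_≡_)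

open import Data.Bool using (true; false; _∧_; _xor_; T)
open import Data.Bool.Properties
  using (T?; xor-assoc; xor-same; xor-identityʳ; ∧-zeroʳ; ∧-distribˡ-xor; ∧-commutativeMonoid)
open import Algebra.Bundles using (CommutativeMonoid)
open import Algebra.Properties.CommutativeSemigroup
  (CommutativeMonoid.commutativeSemigroup ∧-commutativeMonoid) using () renaming (x∙yz≈y∙xz to ∧-leftComm)
open import Data.Fin.Properties using (toℕ<n)
open import Data.List using (List; []; _∷_; map; _++_; filter; length)
open import Data.List.Properties
  using (map-++; map-∘; map-cong; length-++; filter-++; filter-≐)
open import Data.Nat using (zero; suc; _%_; _<_; _≡ᵇ_; s≤s; z≤n; NonZero)
open import Data.Nat.DivMod
  using ( n/1≡n; [m+kn]%n≡m%n; m*n/n≡m; +-distrib-/-∣ʳ; m/n/o≡m/[n*o]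
        ; m%[n*o]/o≡m/o%n; %-congʳ; m∣n⇒o%n%m≡o%m; m/n≡1+[m∸n]/n)
open import Data.Nat.Divisibility using (m∣m*n; n∣m*n)
open import Data.Nat.Properties using (m^n≢0; m*n≢0; *-comm; +-comm; +-identityʳ; m+n∸n≡m)
open import Data.Nat.Tactic.RingSolver using (solve-∀)
open import Data.Product using (_,_)
open import Data.Vec using ([]; _∷_)
open import Function using (_∘_; const)
open import Relation.Binary.PropositionalEquality
  using (refl; sym; trans; cong; cong₂; subst; _≗_; module ≡-Reasoning)
open import Relation.Nullary using (does)
open import Relation.Unary using (Pred; Decidable)

open ≡-Reasoning

length-filter-map : ∀ {a b p} {A : Set a} {B : Set b} {P : Pred B p}
  (P? : Decidable P) (f : A → B) (xs : List A) →
  length (filter P? (map f xs)) ≡ length (filter (P? ∘ f) xs)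
length-filter-map P? f []       = refl
length-filter-map P? f (x ∷ xs) with does (P? (f x))
... | true  = cong suc (length-filter-map P? f xs)
... | false = length-filter-map P? f xs

xor-cancelˡ : ∀ p q → p xor (p xor q) ≡ q
xor-cancelˡ p q = trans (sym (xor-assoc p p q)) (cong (_xor q) (xor-same p))

xorList-++ : (bs cs : List Bool) → xorList (bs ++ cs) ≡ xorList bs xor xorList cs
xorList-++ []       cs = refl
xorList-++ (b ∷ bs) cs =
  trans (cong (b xor_) (xorList-++ bs cs)) (sym (xor-assoc b _ _))

xorList-map-∧ : ∀ a (bs : List Bool) → xorList (map (a ∧_) bs) ≡ a ∧ xorList bs
xorList-map-∧ a []       = sym (∧-zeroʳ a)
xorList-map-∧ a (b ∷ bs) =
  trans (cong ((a ∧ b) xor_) (xorList-map-∧ a bs)) (sym (∧-distribˡ-xor a b _))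

infixl 6 _⊕_
_⊕_ : ∀ {a} {A : Set a} → (A → Bool) → (A → Bool) → A → Bool
(f ⊕ g) x = f x xor g x

numMonomials-∷ : ∀ {w} (c : Monomial (suc w) → Bool) →
  numMonomials c ≡ numMonomials (c ∘ (false ∷_)) + numMonomials (c ∘ (true ∷_))
numMonomials-∷ {w} c = begin
  length (filter P? (map (false ∷_) vs ++ map (true ∷_) vs))
    ≡⟨ cong length (filter-++ P? (map (false ∷_) vs) _) ⟩
  length (filter P? (map (false ∷_) vs) ++ filter P? (map (true ∷_) vs))
    ≡⟨ length-++ (filter P? (map (false ∷_) vs)) ⟩
  length (filter P? (map (false ∷_) vs)) + length (filter P? (map (true ∷_) vs))
    ≡⟨ cong₂ _+_ (length-filter-map P? (false ∷_) vs) (length-filter-map P? (true ∷_) vs) ⟩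
  numMonomials (c ∘ (false ∷_)) + numMonomials (c ∘ (true ∷_)) ∎
  where
  vs = allVecs w
  P? = λ S → T? (c S)

numMonomials-cong : ∀ {w} {c c′ : Monomial w → Bool} → c ≗ c′ →
  numMonomials c ≡ numMonomials c′
numMonomials-cong {w} {c} {c′} c≗c′ =
  cong length (filter-≐ (T? ∘ c) (T? ∘ c′)
    ((λ {S} → subst T (c≗c′ S)) , (λ {S} → subst T (sym (c≗c′ S)))) (allVecs w))

evalPoly-∷ : ∀ {w} (c : Monomial (suc w) → Bool) x (xs : Word w) →
  evalPoly c (x ∷ xs) ≡ evalPoly (c ∘ (false ∷_)) xs xor (x ∧ evalPoly (c ∘ (true ∷_)) xs)
evalPoly-∷ {w} c x xs = begin
  xorList (map term (map (false ∷_) vs ++ map (true ∷_) vs))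
    ≡⟨ cong xorList (map-++ term (map (false ∷_) vs) _) ⟩
  xorList (map term (map (false ∷_) vs) ++ map term (map (true ∷_) vs))
    ≡⟨ xorList-++ (map term (map (false ∷_) vs)) _ ⟩
  xorList (map term (map (false ∷_) vs)) xor xorList (map term (map (true ∷_) vs))
    ≡⟨ cong₂ _xor_ (cong xorList (sym (map-∘ vs))) (cong xorList (sym (map-∘ vs))) ⟩
  e₀ xor xorList (map (term ∘ (true ∷_)) vs)
    ≡⟨ cong (λ t → e₀ xor xorList t) (trans (map-cong pull-x vs) (map-∘ vs)) ⟩
  e₀ xor xorList (map (x ∧_) (map term₁ vs))
    ≡⟨ cong (e₀ xor_) (xorList-map-∧ x (map term₁ vs)) ⟩
  e₀ xor (x ∧ evalPoly (c ∘ (true ∷_)) xs) ∎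
  where
  vs = allVecs w
  e₀ = evalPoly (c ∘ (false ∷_)) xs
  term = λ S → c S ∧ evalMonomial S (x ∷ xs)
  term₁ = λ S → c (true ∷ S) ∧ evalMonomial S xs
  pull-x : ∀ S → term (true ∷ S) ≡ x ∧ term₁ S
  pull-x S = ∧-leftComm (c (true ∷ S)) x (evalMonomial S xs)

-- The binary Möbius transform.
anf : ∀ {w} → (Word w → Bool) → Monomial w → Bool
anf {zero}  f []          = f []
anf {suc w} f (false ∷ S) = anf (f ∘ (false ∷_)) S
anf {suc w} f (true  ∷ S) = anf (f ∘ (false ∷_) ⊕ f ∘ (true ∷_)) S

anf-cong : ∀ {w} {f g : Word w → Bool} → f ≗ g → anf f ≗ anf g
anf-cong {zero}  f≗g []          = f≗g []
anf-cong {suc w} f≗g (false ∷ S) = anf-cong (f≗g ∘ (false ∷_)) S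
anf-cong {suc w} f≗g (true  ∷ S) =
  anf-cong (λ xs → cong₂ _xor_ (f≗g (false ∷ xs)) (f≗g (true ∷ xs))) S

evalPoly-anf : ∀ {w} (f : Word w → Bool) → IsANF f (anf f)
evalPoly-anf {zero}  f []       with f []
... | true  = refl
... | false = refl
evalPoly-anf {suc w} f (x ∷ xs) = begin
  evalPoly (anf f) (x ∷ xs)
    ≡⟨ evalPoly-∷ (anf f) x xs ⟩
  evalPoly (anf f₀) xs xor (x ∧ evalPoly (anf (f₀ ⊕ f₁)) xs)
    ≡⟨ cong₂ (λ p q → p xor (x ∧ q)) (evalPoly-anf f₀ xs) (evalPoly-anf (f₀ ⊕ f₁) xs) ⟩
  f₀ xs xor (x ∧ (f₀ xs xor f₁ xs))
    ≡⟨ interpolate x ⟩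
  f (x ∷ xs) ∎
  where
  f₀ f₁ : Word w → Bool
  f₀ = f ∘ (false ∷_)
  f₁ = f ∘ (true ∷_)
  interpolate : ∀ x → f₀ xs xor (x ∧ (f₀ xs xor f₁ xs)) ≡ f (x ∷ xs)
  interpolate false = xor-identityʳ (f₀ xs)
  interpolate true  = xor-cancelˡ (f₀ xs) (f₁ xs)

anf-evalPoly : ∀ {w} (c : Monomial w → Bool) → anf (evalPoly c) ≗ c
anf-evalPoly {zero}  c [] with c []
... | true  = refl
... | false = refl
anf-evalPoly {suc w} c (false ∷ S) = begin
  anf (evalPoly c ∘ (false ∷_)) S
    ≡⟨ anf-cong (λ xs → trans (evalPoly-∷ c false xs) (xor-identityʳ _)) S ⟩
  anf (evalPoly (c ∘ (false ∷_))) S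
    ≡⟨ anf-evalPoly (c ∘ (false ∷_)) S ⟩
  c (false ∷ S) ∎
anf-evalPoly {suc w} c (true ∷ S) = begin
  anf (evalPoly c ∘ (false ∷_) ⊕ evalPoly c ∘ (true ∷_)) S
    ≡⟨ anf-cong derivative S ⟩
  anf (evalPoly (c ∘ (true ∷_))) S
    ≡⟨ anf-evalPoly (c ∘ (true ∷_)) S ⟩
  c (true ∷ S) ∎
  where
  derivative : evalPoly c ∘ (false ∷_) ⊕ evalPoly c ∘ (true ∷_) ≗ evalPoly (c ∘ (true ∷_))
  derivative xs
    rewrite evalPoly-∷ c false xs | evalPoly-∷ c true xs
          | xor-identityʳ (evalPoly (c ∘ (false ∷_)) xs)
    = xor-cancelˡ (evalPoly (c ∘ (false ∷_)) xs) _

anf-unique : ∀ {w} {f : Word w → Bool} {c : Monomial w → Bool} → IsANF f c → c ≗ anf f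
anf-unique {c = c} isANF S = trans (sym (anf-evalPoly c S)) (anf-cong isANF S)

anfSize : ∀ {w} → (Word w → Bool) → ℕ
anfSize f = numMonomials (anf f)

anfSize-∷ : ∀ {w} (f : Word (suc w) → Bool) →
  anfSize f ≡ anfSize (f ∘ (false ∷_)) + anfSize (f ∘ (false ∷_) ⊕ f ∘ (true ∷_))
anfSize-∷ f = numMonomials-∷ (anf f)

anfSize-cong : ∀ {w} {f g : Word w → Bool} → f ≗ g → anfSize f ≡ anfSize g
anfSize-cong f≗g = numMonomials-cong (anf-cong f≗g)

anfSize-const : ∀ {w} β → anfSize {w} (const β) ≡ bitVal β
anfSize-const {zero}  false = refl
anfSize-const {zero}  true  = refl
anfSize-const {suc w} false =
  trans (anfSize-∷ {w} (const false)) (cong₂ _+_ (anfSize-const {w} false) (anfSize-const {w} false))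
anfSize-const {suc w} true  =
  trans (anfSize-∷ {w} (const true)) (cong₂ _+_ (anfSize-const {w} true) (anfSize-const {w} false))

anfSize-self-⊕ : ∀ {w} (f g : Word w → Bool) → anfSize (f ⊕ f ⊕ g) ≡ anfSize g
anfSize-self-⊕ f g = anfSize-cong (λ x → cong (_xor g x) (xor-same (f x)))

anfSize-⊕-self : ∀ {w} (f g : Word w → Bool) → anfSize (g ⊕ (f ⊕ f)) ≡ anfSize g
anfSize-⊕-self f g =
  anfSize-cong (λ x → trans (cong (g x xor_) (xor-same (f x))) (xor-identityʳ (g x)))

infixl 7 _mod2^_
_mod2^_ : ℕ → ℕ → ℕ
n mod2^ w = _%_ n (2 ^ w) {{m^n≢0 2 w}}

bit-suc : ∀ n b → bit n (suc b) ≡ bit (n / 2) b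
bit-suc n b = cong (λ q → q % 2 ≡ᵇ 1)
  (sym (m/n/o≡m/[n*o] n 2 (2 ^ b) {{_}} {{m^n≢0 2 b}} {{m^n≢0 2 (suc b)}}))

bit-mod2^ : ∀ n b w → b < w → bit (n mod2^ w) b ≡ bit n b
bit-mod2^ n zero    (suc w) _ = cong (_≡ᵇ 1) (begin
  n mod2^ suc w / 1 % 2 ≡⟨ cong (_% 2) (n/1≡n (n mod2^ suc w)) ⟩
  n mod2^ suc w % 2     ≡⟨ m∣n⇒o%n%m≡o%m 2 (2 ^ suc w) n {{_}} {{m^n≢0 2 (suc w)}} (m∣m*n (2 ^ w)) ⟩
  n % 2                 ≡⟨ cong (_% 2) (n/1≡n n) ⟨
  n / 1 % 2             ∎)
bit-mod2^ n (suc b) (suc w) (s≤s b<w) = begin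
  bit (n mod2^ suc w) (suc b)   ≡⟨ bit-suc (n mod2^ suc w) b ⟩
  bit (n mod2^ suc w / 2) b     ≡⟨ cong (λ m → bit m b) halve ⟩
  bit (n / 2 mod2^ w) b         ≡⟨ bit-mod2^ (n / 2) b w b<w ⟩
  bit (n / 2) b                 ≡⟨ bit-suc n b ⟨
  bit n (suc b)                 ∎
  where
  instance
    2^w≢0 : NonZero (2 ^ w)
    2^w≢0 = m^n≢0 2 w
  halve : n mod2^ suc w / 2 ≡ n / 2 mod2^ w
  halve = trans (cong (_/ 2) (%-congʳ {{m^n≢0 2 (suc w)}} {{m*n≢0 (2 ^ w) 2}} (*-comm 2 (2 ^ w))))
                (m%[n*o]/o≡m/o%n n (2 ^ w) 2 {{_}} {{_}} {{m*n≢0 (2 ^ w) 2}})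

bit-zero-+*2 : ∀ d q → bit (d + q * 2) 0 ≡ (d % 2 ≡ᵇ 1)
bit-zero-+*2 d q = cong (_≡ᵇ 1) (begin
  (d + q * 2) / 1 % 2 ≡⟨ cong (_% 2) (n/1≡n (d + q * 2)) ⟩
  (d + q * 2) % 2     ≡⟨ [m+kn]%n≡m%n d q 2 ⟩
  d % 2               ∎)

+*2/2 : ∀ d q → (d + q * 2) / 2 ≡ d / 2 + q
+*2/2 d q = trans (+-distrib-/-∣ʳ d (n∣m*n q)) (cong (d / 2 +_) (m*n/n≡m q 2))

-- Schoolbook evaluation of bit b of m · value x + c; the [] clause is junk,
-- so this agrees with bit only for b < w.
mulAddBit : ∀ {w} → ℕ → ℕ → ℕ → Word w → Bool
mulAddBit m c b       []       = false
mulAddBit m c zero    (x ∷ xs) = (m * bitVal x + c) % 2 ≡ᵇ 1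
mulAddBit m c (suc b) (x ∷ xs) = mulAddBit m ((m * bitVal x + c) / 2) b xs

*value-∷+ : ∀ m c x {w} (xs : Word w) →
  m * value (x ∷ xs) + c ≡ (m * bitVal x + c) + m * value xs * 2
*value-∷+ m c x xs = distribute m c (bitVal x) (value xs)
  where
  distribute : ∀ m c a v → m * (a + 2 * v) + c ≡ (m * a + c) + m * v * 2
  distribute = solve-∀

bit-*value+ : ∀ m c b {w} (x : Word w) → b < w → bit (m * value x + c) b ≡ mulAddBit m c b x
bit-*value+ m c zero    (x ∷ xs) _ = begin
  bit (m * value (x ∷ xs) + c) 0              ≡⟨ cong (λ n → bit n 0) (*value-∷+ m c x xs) ⟩
  bit (m * bitVal x + c + m * value xs * 2) 0 ≡⟨ bit-zero-+*2 (m * bitVal x + c) (m * value xs) ⟩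
  mulAddBit m c 0 (x ∷ xs)                    ∎
bit-*value+ m c (suc b) (x ∷ xs) (s≤s b<w) = begin
  bit (m * value (x ∷ xs) + c) (suc b)   ≡⟨ bit-suc (m * value (x ∷ xs) + c) b ⟩
  bit ((m * value (x ∷ xs) + c) / 2) b   ≡⟨ cong (λ n → bit n b) halve ⟩
  bit (m * value xs + d / 2) b           ≡⟨ bit-*value+ m (d / 2) b xs b<w ⟩
  mulAddBit m c (suc b) (x ∷ xs)         ∎
  where
  d = m * bitVal x + c
  halve : (m * value (x ∷ xs) + c) / 2 ≡ m * value xs + d / 2
  halve = begin
    (m * value (x ∷ xs) + c) / 2 ≡⟨ cong (_/ 2) (*value-∷+ m c x xs) ⟩
    (d + m * value xs * 2) / 2   ≡⟨ +*2/2 d (m * value xs) ⟩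
    d / 2 + m * value xs         ≡⟨ +-comm (d / 2) (m * value xs) ⟩
    m * value xs + d / 2         ∎

-- With literal carry c and literal x₀ the new carry ⌊(3x₀ + c)/2⌋ computes,
-- so the cofactors of tripleBit c (suc b) are tripleBit c′ b by definition.
tripleBit : ∀ {w} → ℕ → ℕ → Word w → Bool
tripleBit = mulAddBit 3

z≡tripleBit : ∀ w (b : Fin w) → z w b ≗ tripleBit 0 (toℕ b)
z≡tripleBit w b x = begin
  bit (3 * value x mod2^ w) (toℕ b) ≡⟨ bit-mod2^ (3 * value x) (toℕ b) w (toℕ<n b) ⟩
  bit (3 * value x) (toℕ b)         ≡⟨ cong (λ n → bit n (toℕ b)) (+-identityʳ (3 * value x)) ⟨
  bit (3 * value x + 0) (toℕ b)     ≡⟨ bit-*value+ 3 0 (toℕ b) x (toℕ<n b) ⟩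
  tripleBit 0 (toℕ b) x             ∎

size₀ size₀₁ size₁₂ : ℕ → ℕ
size₀  zero    = 1
size₀  (suc b) = size₀ b + size₀₁ b
size₀₁ zero    = 1
size₀₁ (suc b) = size₁₂ b
size₁₂ zero    = 1
size₁₂ (suc b) = 2 * size₀₁ b

anfSize-tripleBit₀  : ∀ b {w} → b < w → anfSize {w} (tripleBit 0 b) ≡ size₀ b
anfSize-tripleBit₀₁ : ∀ b {w} → b < w → anfSize {w} (tripleBit 0 b ⊕ tripleBit 1 b) ≡ size₀₁ b
anfSize-tripleBit₁₂ : ∀ b {w} → b < w → anfSize {w} (tripleBit 1 b ⊕ tripleBit 2 b) ≡ size₁₂ b

anfSize-tripleBit₀ zero {suc w} _ =
  trans (anfSize-∷ {w} (tripleBit 0 0)) (cong₂ _+_ (anfSize-const {w} false) (anfSize-const {w} true))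
anfSize-tripleBit₀ (suc b) {suc w} (s≤s b<w) =
  trans (anfSize-∷ {w} (tripleBit 0 (suc b)))
        (cong₂ _+_ (anfSize-tripleBit₀ b {w} b<w) (anfSize-tripleBit₀₁ b {w} b<w))

anfSize-tripleBit₀₁ zero {suc w} _ =
  trans (anfSize-∷ {w} (tripleBit 0 0 ⊕ tripleBit 1 0))
        (cong₂ _+_ (anfSize-const {w} true) (anfSize-const {w} false))
anfSize-tripleBit₀₁ (suc b) {suc w} (s≤s b<w) =
  trans (anfSize-∷ {w} (tripleBit 0 (suc b) ⊕ tripleBit 1 (suc b)))
        (cong₂ _+_ (trans (anfSize-cong {w} (xor-same ∘ tripleBit 0 b)) (anfSize-const {w} false))
                   (trans (anfSize-self-⊕ {w} (tripleBit 0 b) (tripleBit 1 b ⊕ tripleBit 2 b))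
                          (anfSize-tripleBit₁₂ b {w} b<w)))

anfSize-tripleBit₁₂ zero {suc w} _ =
  trans (anfSize-∷ {w} (tripleBit 1 0 ⊕ tripleBit 2 0))
        (cong₂ _+_ (anfSize-const {w} true) (anfSize-const {w} false))
anfSize-tripleBit₁₂ (suc b) {suc w} (s≤s b<w) =
  trans (anfSize-∷ {w} (tripleBit 1 (suc b) ⊕ tripleBit 2 (suc b)))
        (trans (cong₂ _+_ (anfSize-tripleBit₀₁ b {w} b<w)
                          (trans (anfSize-⊕-self {w} (tripleBit 2 b) (tripleBit 0 b ⊕ tripleBit 1 b))
                                 (anfSize-tripleBit₀₁ b {w} b<w)))
               (cong (size₀₁ b +_) (sym (+-identityʳ (size₀₁ b)))))

size₀+1≡size₀₁+size₁₂ : ∀ b → size₀ b + 1 ≡ size₀₁ b + size₁₂ b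
size₀+1≡size₀₁+size₁₂ zero    = refl
size₀+1≡size₀₁+size₁₂ (suc b) = begin
  size₀ b + size₀₁ b + 1          ≡⟨ swap (size₀ b) (size₀₁ b) ⟩
  size₀ b + 1 + size₀₁ b          ≡⟨ cong (_+ size₀₁ b) (size₀+1≡size₀₁+size₁₂ b) ⟩
  size₀₁ b + size₁₂ b + size₀₁ b  ≡⟨ rearrange (size₀₁ b) (size₁₂ b) ⟩
  size₁₂ b + 2 * size₀₁ b         ∎
  where
  swap : ∀ a y → a + y + 1 ≡ a + 1 + y
  swap = solve-∀
  rearrange : ∀ y z → y + z + y ≡ z + 2 * y
  rearrange = solve-∀

size₀+1-doubles : ∀ b → size₀ (2 + b) + 1 ≡ 2 * (size₀ b + 1)
size₀+1-doubles b = begin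
  size₀ b + size₀₁ b + size₁₂ b + 1     ≡⟨ regroup (size₀ b) (size₀₁ b) (size₁₂ b) ⟩
  size₀ b + 1 + (size₀₁ b + size₁₂ b)   ≡⟨ cong (size₀ b + 1 +_) (size₀+1≡size₀₁+size₁₂ b) ⟨
  size₀ b + 1 + (size₀ b + 1)           ≡⟨ double (size₀ b + 1) ⟩
  2 * (size₀ b + 1)                     ∎
  where
  regroup : ∀ a y z → a + y + z + 1 ≡ a + 1 + (y + z)
  regroup = solve-∀
  double : ∀ n → n + n ≡ 2 * n
  double = solve-∀

closedForm-doubles : ∀ b → (2 + (2 + b) % 2) * 2 ^ ((2 + b) / 2) ≡ 2 * ((2 + b % 2) * 2 ^ (b / 2))
-- (2 + b) % 2 reduces to b % 2 by computation.
closedForm-doubles b = begin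
  (2 + b % 2) * 2 ^ ((2 + b) / 2)
    ≡⟨ cong (λ e → (2 + b % 2) * 2 ^ e) (m/n≡1+[m∸n]/n {2 + b} {2} (s≤s (s≤s z≤n))) ⟩
  (2 + b % 2) * (2 * 2 ^ (b / 2))     ≡⟨ leftComm (2 + b % 2) (2 ^ (b / 2)) ⟩
  2 * ((2 + b % 2) * 2 ^ (b / 2))     ∎
  where
  leftComm : ∀ r p → r * (2 * p) ≡ 2 * (r * p)
  leftComm = solve-∀

size₀-closedForm : ∀ b → size₀ b + 1 ≡ (2 + b % 2) * 2 ^ (b / 2)
size₀-closedForm zero          = refl
size₀-closedForm (suc zero)    = refl
size₀-closedForm (suc (suc b)) = begin
  size₀ (2 + b) + 1                   ≡⟨ size₀+1-doubles b ⟩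
  2 * (size₀ b + 1)                   ≡⟨ cong (2 *_) (size₀-closedForm b) ⟩
  2 * ((2 + b % 2) * 2 ^ (b / 2))     ≡⟨ closedForm-doubles b ⟨
  (2 + (2 + b) % 2) * 2 ^ ((2 + b) / 2) ∎

theorem10p4 : (w : ℕ) → 1 ≤ w → (b : Fin w) →
    (∃[ c ] IsANF (z w b) c)
    × (∀ (c : Monomial w → Bool) → IsANF (z w b) c →
        numMonomials c ≡ (2 + oddInd (toℕ b)) * 2 ^ (toℕ b / 2) ∸ 1)
theorem10p4 w _ b = (anf (z w b) , evalPoly-anf (z w b)) , counted
  where
  counted : ∀ (c : Monomial w → Bool) → IsANF (z w b) c →
    numMonomials c ≡ (2 + oddInd (toℕ b)) * 2 ^ (toℕ b / 2) ∸ 1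
  counted c isANF = begin
    numMonomials c                      ≡⟨ numMonomials-cong (anf-unique isANF) ⟩
    anfSize (z w b)                     ≡⟨ anfSize-cong (z≡tripleBit w b) ⟩
    anfSize {w} (tripleBit 0 (toℕ b))   ≡⟨ anfSize-tripleBit₀ (toℕ b) (toℕ<n b) ⟩
    size₀ (toℕ b)                       ≡⟨ m+n∸n≡m (size₀ (toℕ b)) 1 ⟨
    size₀ (toℕ b) + 1 ∸ 1               ≡⟨ cong (_∸ 1) (size₀-closedForm (toℕ b)) ⟩
    (2 + oddInd (toℕ b)) * 2 ^ (toℕ b / 2) ∸ 1 ∎
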